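{- Let $G$ be a graph, let $s\in\mathbb{N}_{\geq 1}\cup\{\infty\}$ and let $k$ be a non-negative integer. The following three statements are equivalent: (1) ${\bf cc}_{s}(G)\leq k$, i.e., there is a cop strategy $f$ on $G$ of cost at most $k$ such that for every robber strategy $R$ on $G$ (for a robber of speed $s$), the pair $(f,R)$ is cop-winning; (2) $G$ has no non-empty $(k+1,s)$-edge-hide-out; (3) $\delta_{\rm e}^{s}(G)\leq k$.
   Context: All graphs are finite, undirected, loopless, and may have parallel edges; $E(G)$ is a multiset and the edge-degree of a vertex counts edges with multiplicity. An $s$-path is a path with at most $s$ edges (for $s=\infty$, any path). For $x\in V(G)$ and $S\subseteq V(G)\setminus\{x\}$, ${\bf supp}_{G,s}(x,S)$ is the minimum size of a set $A\subseteq E(G)$ such that every $s$-path of $G$ from $x$ to a vertex of $S$ contains an edge of $A$ (it is $0$ if $S=\emptyset$). For a layout (linear ordering) $L=\langle v_1,\dots,v_n\rangle$ of $V(G)$, its $s$-edge-degeneracy is $\max_{i\in[n]}{\bf supp}_{G,s}(v_i,\{v_1,\dots,v_{i-1}\})$, and $\delta_{\rm e}^{s}(G)$ is the minimum of this over all layouts of $V(G)$. A $(k,s)$-edge-hide-out is a set $R\subseteq V(G)$ such that ${\bf supp}_{G,s}(x,R\setminus\{x\})\geq k$ for every $x\in R$. Search game: a cop strategy is a function $f:V(G)\to 2^{E(G)}$, with cost $\max_{v}|f(v)|$. A robber strategy is a pair $R=(v_{\rm start},g)$ with $v_{\rm start}\in V(G)$ and $g:2^{E(G)}\times V(G)\to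 V(G)$ such that for every $F\subseteq E(G)$ and $v\in V(G)$, $g(F,v)$ is either $v$ or a vertex $u\neq v$ joined to $v$ by an $s$-path in the graph $(V(G),E(G)\setminus F)$. The game scenario of $(f,R)$ is the sequence $v_0,F_1,v_1,F_2,v_2,\dots$ with $v_0=v_{\rm start}$, $F_i=f(v_{i-1})$, $v_i=g(F_i,v_{i-1})$ for $i\geq1$. The pair $(f,R)$ is cop-winning if $v_i=v_{i-1}$ for some $i\geq 1$, and robber-winning otherwise. ${\bf cc}_s(G)$ is the minimum $k$ for which there is a cop strategy of cost at most $k$ that is cop-winning against every robber strategy. -}

module Defs where

open import Level using (0ℓ)
open import Data.Nat as ℕ using (ℕ; zero; suc; _≤_)
open import Data.Fin as Fin using (Fin)
open import Data.Fin.Subset using (Subset; _∈_; _∉_; ∣_∣; Nonempty)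
open import Data.Product using (Σ; ∃; ∃-syntax; _×_; _,_; proj₁; proj₂)
open import Data.Sum using (_⊎_)
open import Data.Unit using (⊤)
open import Data.Empty using (⊥)
open import Data.List using (List; []; _∷_; length)
open import Data.List.Relation.Unary.Any using (Any)
open import Data.List.Relation.Unary.All using (All)
open import Data.List.Relation.Unary.Unique.Propositional using (Unique)
open import Relation.Nullary using (¬_)
open import Relation.Unary using (Pred)
open import Relation.Binary.PropositionalEquality using (_≡_; _≢_)
open import Function.Definitions using (Injective)

-- A finite loopless multigraph: vertices Fin n, edges Fin m (so E(G) is a
-- multiset: distinct edge names may have the same endpoints).
record Graph : Set where
  field
    n        : ℕ
    m        : ℕ
    ends     : Fin m → Fin n × Fin n
    loopless : ∀ e → proj₁ (ends e) ≢ proj₂ (ends e)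

data Speed : Set where
  fin : ℕ → Speed
  ∞   : Speed

ValidSpeed : Speed → Set
ValidSpeed (fin s) = 1 ≤ s
ValidSpeed ∞       = ⊤

_≤ₛ_ : ℕ → Speed → Set
l ≤ₛ fin s = l ≤ s
l ≤ₛ ∞     = ⊤

module _ (G : Graph) where
  open Graph G

  V : Set
  V = Fin n

  Joins : Fin m → V → V → Set
  Joins e x y = ends e ≡ (x , y) ⊎ ends e ≡ (y , x)

  data Walk : V → V → Set where
    []  : ∀ {x} → Walk x x
    _∷_ : ∀ {x y z} → Σ (Fin m) (λ e → Joins e x y) → Walk y z → Walk x z

  vertices : ∀ {x y} → Walk x y → List V
  vertices {x} []            = x ∷ []
  vertices {x} (_ ∷ w)       = x ∷ vertices w

  edges : ∀ {x y} → Walk x y → List (Fin m)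
  edges []             = []
  edges ((e , _) ∷ w)  = e ∷ edges w

  IsPath : ∀ {x y} → Walk x y → Set
  IsPath w = Unique (vertices w)

  IsSPath : Speed → ∀ {x y} → Walk x y → Set
  IsSPath s w = IsPath w × (length (edges w) ≤ₛ s)

  Blocks : Speed → V → Pred V 0ℓ → Subset m → Set
  Blocks s x S A = ∀ y → S y → (p : Walk x y) → IsSPath s p →
                   Any (λ e → e ∈ A) (edges p)

  IsSupp : Speed → V → Pred V 0ℓ → ℕ → Set
  IsSupp s x S j =
    (∃[ A ] (Blocks s x S A × ∣ A ∣ ≡ j)) ×
    (∀ A → Blocks s x S A → j ≤ ∣ A ∣)

  minus : Subset n → V → Pred V 0ℓ
  minus R x y = y ∈ R × y ≢ x

  IsHideOut : ℕ → Speed → Subset n → Set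
  IsHideOut k s R = ∀ x → x ∈ R → ∀ j → IsSupp s x (minus R x) j → k ≤ j

  record Layout : Set where
    field
      at  : Fin n → V
      inj : Injective _≡_ _≡_ at

  before : Layout → Fin n → Pred V 0ℓ
  before L i y = ∃[ j ] (j Fin.< i × Layout.at L j ≡ y)

  LayoutDegAtMost : Speed → Layout → ℕ → Set
  LayoutDegAtMost s L k =
    ∀ i → ∃[ j ] (IsSupp s (Layout.at L i) (before L i) j × j ≤ k)

  EdgeDegAtMost : Speed → ℕ → Set
  EdgeDegAtMost s k = ∃[ L ] LayoutDegAtMost s L k

  CopStrategy : Set
  CopStrategy = V → Subset m

  CostAtMost : CopStrategy → ℕ → Set
  CostAtMost f k = ∀ v → ∣ f v ∣ ≤ k

  SPathAvoiding : Speed → Subset m → V → V → Set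
  SPathAvoiding s F v u = Σ (Walk v u) λ p → IsSPath s p × All (λ e → e ∉ F) (edges p)

  record RobberStrategy (s : Speed) : Set where
    field
      start : V
      g     : Subset m → V → V
      valid : ∀ F v → g F v ≡ v ⊎ (g F v ≢ v × SPathAvoiding s F v (g F v))

  position : ∀ {s} → CopStrategy → RobberStrategy s → ℕ → V
  position f R zero    = RobberStrategy.start R
  position f R (suc i) = RobberStrategy.g R (f (position f R i)) (position f R i)

  CopWinning : ∀ {s} → CopStrategy → RobberStrategy s → Set
  CopWinning f R = ∃[ i ] (position f R (suc i) ≡ position f R i)

  CopNumberAtMost : Speed → ℕ → Set
  CopNumberAtMost s k =
    ∃[ f ] (CostAtMost f k × ((R : RobberStrategy s) → CopWinning f R))

  NoNonemptyHideOut : ℕ → Speed → Set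
  NoNonemptyHideOut k s = ∀ R → Nonempty R → ¬ IsHideOut k s R

-- A layout of s-edge-degeneracy at most k yields the cop strategy that, with the robber at v,
-- cuts all s-paths from v back to the vertices before v in the layout; the robber can then only
-- move forward, so it must eventually stay put. Conversely, inside a non-empty (k+1,s)-edge-hide-out
-- no k edges cut the robber off from the rest of it, so it can always move on. Finally, if there is
-- no such hide-out, every non-empty vertex set has a vertex that k edges separate from the others;
-- peeling such vertices off one by one and listing them in reverse order gives the layout.

module Submission where

open import Data.Nat using (ℕ; suc)
open import Data.Product using (_×_)
open import Function.Bundles using (_⇔_)
open import Defs

open import Level using (0ℓ)
open import Data.Nat.Base as ℕ using (zero; _≤_; _<_; z≤n; s≤s)
import Data.Nat.Properties as ℕ
open import Data.Nat.Induction using (<-rec)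
open import Data.Fin.Base as Fin using (Fin; toℕ; opposite; punchOut)
import Data.Fin.Properties as Fin
open import Data.Fin.Subset using (Subset; _∈_; _∉_; ∣_∣; Nonempty; inside; outside; _-_; ⊤)
open import Data.Fin.Subset.Properties
  using (_∈?_; anySubset?; nonempty?; Empty-unique; ∣⊥∣≡0; ∣⊤∣≡n; ∈⊤; p─⊥≡p; p─q⊆p)
open import Data.Product using (Σ; ∃; ∃₂; _,_; proj₁; proj₂)
open import Data.Product.Properties using (≡-dec)
open import Data.Sum using (_⊎_; inj₁; inj₂; [_,_]′)
open import Data.Unit using (tt)
open import Data.Empty using (⊥-elim)
open import Data.List.Base using (List; length; lookup)
open import Data.Vec.Base using (_∷_; there)
open import Data.List.Membership.Propositional.Properties using (∈-lookup)
import Data.List.Relation.Unary.Any as Any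
open import Data.List.Relation.Unary.All as All using (All)
open import Data.List.Relation.Unary.All.Properties using (All¬⇒¬Any; ¬Any⇒All¬)
open import Data.List.Relation.Unary.AllPairs using (_∷_)
open import Data.List.Relation.Unary.Unique.Propositional using (Unique)
open import Data.List.Relation.Unary.Unique.DecPropositional using (unique?)
open import Relation.Nullary using (¬_; Dec; yes; no; ¬?; contradiction)
open import Relation.Nullary.Decidable using (_×-dec_; _⊎-dec_; map′)
open import Relation.Unary using (Pred; Decidable; _⊆_)
open import Relation.Binary.Definitions using (DecidableEquality)
open import Relation.Binary.PropositionalEquality
  using (_≡_; _≢_; refl; sym; trans; cong; subst; module ≡-Reasoning)
open import Function.Base using (_∘_; id)
open import Function.Bundles using (mk⇔; Equivalence)
open import Function.Definitions using (Injective)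
open import Axiom.UniquenessOfIdentityProofs using (module Decidable⇒UIP)

lookup-injective : ∀ {A : Set} {xs : List A} → Unique xs → Injective _≡_ _≡_ (lookup xs)
lookup-injective (_ ∷ _) {Fin.zero} {Fin.zero} _ = refl
lookup-injective (x∉xs ∷ _) {Fin.zero} {Fin.suc j} eq = ⊥-elim (All.lookup x∉xs (∈-lookup j) eq)
lookup-injective (x∉xs ∷ _) {Fin.suc i} {Fin.zero} eq = ⊥-elim (All.lookup x∉xs (∈-lookup i) (sym eq))
lookup-injective (_ ∷ u) {Fin.suc i} {Fin.suc j} eq = cong Fin.suc (lookup-injective u eq)

unique⇒length≤ : ∀ {t} {xs : List (Fin t)} → Unique xs → length xs ≤ t
unique⇒length≤ u = Fin.injective⇒≤ (lookup-injective u)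

-- If v were missed, punching it out would inject Fin (suc t) into Fin t.
injective⇒surjective : ∀ {t} {f : Fin t → Fin t} → Injective _≡_ _≡_ f →
                       ∀ v → ∃ λ i → f i ≡ v
injective⇒surjective {zero} _ ()
injective⇒surjective {suc t} {f} f-inj v with Fin.any? (λ i → f i Fin.≟ v)
... | yes hit = hit
... | no miss = ⊥-elim (ℕ.1+n≰n (Fin.injective⇒≤ punched-injective))
  where
  missed : ∀ i → v ≢ f i
  missed i eq = miss (i , sym eq)
  punched-injective : Injective _≡_ _≡_ (λ i → punchOut (missed i))
  punched-injective eq = f-inj (Fin.punchOut-injective (missed _) (missed _) eq)

opposite-injective : ∀ {t} → Injective _≡_ _≡_ (opposite {t})
opposite-injective {_} {i} {j} eq = begin
  i                       ≡⟨ Fin.opposite-involutive i ⟨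
  opposite (opposite i)   ≡⟨ cong opposite eq ⟩
  opposite (opposite j)   ≡⟨ Fin.opposite-involutive j ⟩
  j                       ∎
  where open ≡-Reasoning

opposite-< : ∀ {t} {i j : Fin t} → j Fin.< i → opposite i Fin.< opposite j
opposite-< {i = i} {j} j<i rewrite Fin.opposite-prop i | Fin.opposite-prop j =
  ℕ.∸-monoʳ-< (s≤s j<i) (Fin.toℕ<n i)

∣p∣≡1+∣p-x∣ : ∀ {t} {p : Subset t} {x} → x ∈ p → ∣ p ∣ ≡ suc ∣ p - x ∣
∣p∣≡1+∣p-x∣ {p = inside ∷ p} {Fin.zero} _ = cong suc (sym (cong ∣_∣ (p─⊥≡p p)))
∣p∣≡1+∣p-x∣ {p = inside ∷ p} {Fin.suc x} (there x∈p) = cong suc (∣p∣≡1+∣p-x∣ x∈p)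
∣p∣≡1+∣p-x∣ {p = outside ∷ p} {Fin.suc x} (there x∈p) = ∣p∣≡1+∣p-x∣ x∈p

x∈p-y⇒x≢y : ∀ {t} {p : Subset t} {x y} → x ∈ p - y → x ≢ y
x∈p-y⇒x≢y {p = _ ∷ _} {Fin.zero} {Fin.zero} ()
x∈p-y⇒x≢y {p = _ ∷ _} {Fin.zero} {Fin.suc y} _ ()
x∈p-y⇒x≢y {p = _ ∷ _} {Fin.suc x} {Fin.zero} _ ()
x∈p-y⇒x≢y {p = _ ∷ _} {Fin.suc x} {Fin.suc y} (there x∈p-y) =
  x∈p-y⇒x≢y x∈p-y ∘ Fin.suc-injective

∣p∣≡1+c⇒Nonempty : ∀ {t} {p : Subset t} {c} → ∣ p ∣ ≡ suc c → Nonempty p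
∣p∣≡1+c⇒Nonempty {t} {p} size with nonempty? p
... | yes nonempty = nonempty
... | no empty with Empty-unique empty
...   | refl = contradiction (trans (sym (∣⊥∣≡0 t)) size) ℕ.0≢1+n

rank-increasing⇒stalls : ∀ {A : Set} {t} → DecidableEquality A → (rank : A → Fin t) (p : ℕ → A) →
                         (∀ i → p (suc i) ≢ p i → rank (p i) Fin.< rank (p (suc i))) →
                         ∃ λ i → p (suc i) ≡ p i
rank-increasing⇒stalls {t = t} _≟_ rank p increasing = conclude (climb t)
  where
  climb : ∀ i → (∃ λ j → p (suc j) ≡ p j) ⊎ i ≤ toℕ (rank (p i))
  climb zero = inj₂ z≤n
  climb (suc i) with climb i | p (suc i) ≟ p i
  ... | inj₁ stall | _      = inj₁ stall
  ... | inj₂ _     | yes eq = inj₁ (i , eq)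
  ... | inj₂ i≤r   | no ne  = inj₂ (ℕ.≤-trans (s≤s i≤r) (increasing i ne))
  conclude : (∃ λ j → p (suc j) ≡ p j) ⊎ t ≤ toℕ (rank (p t)) → ∃ λ i → p (suc i) ≡ p i
  conclude (inj₁ stall) = stall
  conclude (inj₂ t≤r)   = ⊥-elim (ℕ.<⇒≱ (Fin.toℕ<n (rank (p t))) t≤r)

_≤ₛ?_ : ∀ l s → Dec (l ≤ₛ s)
l ≤ₛ? fin s = l ℕ.≤? s
l ≤ₛ? ∞     = yes tt

module _ (G : Graph) where
  open Graph G using (n; m; ends; loopless)

  _≟ₚ_ : DecidableEquality (Fin n × Fin n)
  _≟ₚ_ = ≡-dec Fin._≟_ Fin._≟_

  joins? : ∀ e x y → Dec (Joins G e x y)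
  joins? e x y = (ends e ≟ₚ (x , y)) ⊎-dec (ends e ≟ₚ (y , x))

  -- The two alternatives of Joins exclude each other because G is loopless.
  joins-irrelevant : ∀ {e x y} (j j′ : Joins G e x y) → j ≡ j′
  joins-irrelevant (inj₁ p) (inj₁ q) = cong inj₁ (Decidable⇒UIP.≡-irrelevant _≟ₚ_ p q)
  joins-irrelevant (inj₂ p) (inj₂ q) = cong inj₂ (Decidable⇒UIP.≡-irrelevant _≟ₚ_ p q)
  joins-irrelevant {e} (inj₁ p) (inj₂ q) =
    ⊥-elim (loopless e (trans (cong proj₁ p) (trans (cong proj₁ (trans (sym p) q)) (sym (cong proj₂ p)))))
  joins-irrelevant (inj₂ p) (inj₁ q) = sym (joins-irrelevant (inj₁ q) (inj₂ p))

  walkLength : ∀ {x y} → Walk G x y → ℕ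
  walkLength w = length (edges G w)

  path-length< : ∀ {x y} (w : Walk G x y) → IsPath G w → walkLength w < n
  path-length< w unique = subst (_≤ n) (vertex-count w) (unique⇒length≤ unique)
    where
    vertex-count : ∀ {x y} (w : Walk G x y) → length (vertices G w) ≡ suc (walkLength w)
    vertex-count []      = refl
    vertex-count (_ ∷ w) = cong suc (vertex-count w)

  ShortWalk : ℕ → (x : V G) → (∀ {y} → Walk G x y → Set) → Set
  ShortWalk L x P = ∃₂ λ y (w : Walk G x y) → walkLength w ≤ L × P w

  ShortWalkVia : ℕ → (x : V G) → (∀ {y} → Walk G x y → Set) → Fin m → V G → Set
  ShortWalkVia L x P e y = Σ (Joins G e x y) λ j → ShortWalk L y (λ w → P ((e , j) ∷ w))

  mutual
    shortWalk? : ∀ L x {P : ∀ {y} → Walk G x y → Set} →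
                 (∀ {y} (w : Walk G x y) → Dec (P w)) → Dec (ShortWalk L x P)
    shortWalk? L x P? with P? []
    ... | yes p = yes (x , [] , z≤n , p)
    shortWalk? zero x P? | no ¬p = no λ { (_ , [] , _ , p) → ¬p p ; (_ , _ ∷ _ , () , _) }
    shortWalk? (suc L) x P? | no ¬p with Fin.any? (λ e → Fin.any? (shortWalkVia? L x P? e))
    ... | yes (e , y , j , z , w , l , p) = yes (z , (e , j) ∷ w , s≤s l , p)
    ... | no ¬via = no λ { (_ , [] , _ , p) → ¬p p
                         ; (z , (e , j) ∷ w , s≤s l , p) → ¬via (e , _ , j , z , w , l , p) }

    shortWalkVia? : ∀ L x {P : ∀ {y} → Walk G x y → Set} →
                    (∀ {y} (w : Walk G x y) → Dec (P w)) → ∀ e y → Dec (ShortWalkVia L x P e y)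
    shortWalkVia? L x P? e y with joins? e x y
    ... | no ¬j = no (¬j ∘ proj₁)
    ... | yes j = map′ (j ,_) (λ { (j′ , r) → subst _ (joins-irrelevant j′ j) r })
                       (shortWalk? L y (λ w → P? ((e , j) ∷ w)))

module _ (G : Graph) (s : Speed) where
  open Graph G using (n; m)

  Escapes : Subset m → V G → Pred (V G) 0ℓ → Set
  Escapes F x S = ∃ λ y → S y × SPathAvoiding G s F x y

  -- An s-path has fewer than n edges, so searching the walks of length at most n suffices.
  escapes? : ∀ F x {S} → Decidable S → Dec (Escapes F x S)
  escapes? F x S? = map′ fromWalk toWalk (shortWalk? G n x (λ {y} w → S? y ×-dec sPath? w ×-dec avoids? w))
    where
    sPath? : ∀ {y} (w : Walk G x y) → Dec (IsSPath G s w)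
    sPath? w = unique? Fin._≟_ (vertices G w) ×-dec (walkLength G w ≤ₛ? s)
    avoids? : ∀ {y} (w : Walk G x y) → Dec (All (_∉ F) (edges G w))
    avoids? w = All.all? (λ e → ¬? (e ∈? F)) (edges G w)
    fromWalk : ShortWalk G n x _ → Escapes F x _
    fromWalk (y , w , _ , sy , sp , av) = y , sy , w , sp , av
    toWalk : Escapes F x _ → ShortWalk G n x _
    toWalk (y , sy , w , sp , av) = y , w , ℕ.<⇒≤ (path-length< G w (proj₁ sp)) , sy , sp , av

  blocks⇒¬escapes : ∀ {x S A} → Blocks G s x S A → ¬ Escapes A x S
  blocks⇒¬escapes blocks (y , sy , w , sp , avoids) = All¬⇒¬Any avoids (blocks y sy w sp)

  ¬escapes⇒blocks : ∀ {x S A} → ¬ Escapes A x S → Blocks G s x S A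
  ¬escapes⇒blocks {A = A} ¬escapes y sy w sp with Any.any? (_∈? A) (edges G w)
  ... | yes hit = hit
  ... | no miss = ⊥-elim (¬escapes (y , sy , w , sp , ¬Any⇒All¬ _ miss))

  blocks? : ∀ {x S} → Decidable S → ∀ A → Dec (Blocks G s x S A)
  blocks? {x} S? A = map′ ¬escapes⇒blocks blocks⇒¬escapes (¬? (escapes? A x S?))

  Blockable : V G → Pred (V G) 0ℓ → ℕ → Set
  Blockable x S k = ∃ λ A → Blocks G s x S A × ∣ A ∣ ≤ k

  blockable? : ∀ {x S} → Decidable S → ∀ k → Dec (Blockable x S k)
  blockable? S? k = anySubset? (λ A → blocks? S? A ×-dec (∣ A ∣ ℕ.≤? k))

  blockable-antitone : ∀ {x S S′ k} → S ⊆ S′ → Blockable x S′ k → Blockable x S k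
  blockable-antitone S⊆S′ (A , blocks , size) = A , (λ y sy → blocks y (S⊆S′ sy)) , size

  supp≤⇔blockable : ∀ {x S j k} → IsSupp G s x S j → (j ≤ k ⇔ Blockable x S k)
  supp≤⇔blockable ((A , blocks , refl) , minimal) =
    mk⇔ (λ j≤k → A , blocks , j≤k) (λ { (B , blocksB , B≤k) → ℕ.≤-trans (minimal B blocksB) B≤k })

  -- Every path to S has an edge since x ∉ S, so the whole edge set blocks; then shrink
  -- by strong induction on the size of a blocking set.
  supp-exists : ∀ {x S} → Decidable S → ¬ S x → ∃ (IsSupp G s x S)
  supp-exists {x} {S} S? x∉S = <-rec Goal minimise m (⊤ , everything-blocks , ∣⊤∣≡n m)
    where
    Goal : ℕ → Set
    Goal j = (∃ λ A → Blocks G s x S A × ∣ A ∣ ≡ j) → ∃ (IsSupp G s x S)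
    minimise : ∀ j → (∀ {i} → i < j → Goal i) → Goal j
    minimise j smaller blocking with anySubset? (λ A → blocks? S? A ×-dec (∣ A ∣ ℕ.<? j))
    ... | yes (A , blocks , A<j) = smaller A<j (A , blocks , refl)
    ... | no ¬smaller = j , blocking , λ A blocks → ℕ.≮⇒≥ (λ A<j → ¬smaller (A , blocks , A<j))
    everything-blocks : Blocks G s x S ⊤
    everything-blocks y sy []      _ = ⊥-elim (x∉S sy)
    everything-blocks y sy (_ ∷ _) _ = Any.here ∈⊤

  minus? : ∀ R v → Decidable (minus G R v)
  minus? R v y = (y ∈? R) ×-dec ¬? (y Fin.≟ v)

  hideOut⇔unblockable : ∀ {k R} →
                        IsHideOut G (suc k) s R ⇔ (∀ x → x ∈ R → ¬ Blockable x (minus G R x) k)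
  hideOut⇔unblockable {k} {R} = mk⇔ unblockable hideOut
    where
    unblockable : IsHideOut G (suc k) s R → ∀ x → x ∈ R → ¬ Blockable x (minus G R x) k
    unblockable isHideOut x x∈R blockable with supp-exists (minus? R x) (λ { (_ , x≢x) → x≢x refl })
    ... | j , supp = ℕ.<⇒≱ (isHideOut x x∈R j supp) (Equivalence.from (supp≤⇔blockable supp) blockable)
    hideOut : (∀ x → x ∈ R → ¬ Blockable x (minus G R x) k) → IsHideOut G (suc k) s R
    hideOut unblockable x x∈R j supp = ℕ.≰⇒> (unblockable x x∈R ∘ Equivalence.to (supp≤⇔blockable supp))

  layoutDeg⇔blockable : ∀ {L k} →
                        LayoutDegAtMost G s L k ⇔ (∀ i → Blockable (Layout.at L i) (before G L i) k)
  layoutDeg⇔blockable {L} {k} = mk⇔ blockable layoutDeg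
    where
    blockable : LayoutDegAtMost G s L k → ∀ i → Blockable (Layout.at L i) (before G L i) k
    blockable deg i with deg i
    ... | j , supp , j≤k = Equivalence.to (supp≤⇔blockable supp) j≤k
    before? : ∀ i → Decidable (before G L i)
    before? i y = Fin.any? (λ j → (j Fin.<? i) ×-dec (Layout.at L j Fin.≟ y))
    not-before-self : ∀ i → ¬ before G L i (Layout.at L i)
    not-before-self i (j , j<i , same) = Fin.<⇒≢ j<i (Layout.inj L same)
    layoutDeg : (∀ i → Blockable (Layout.at L i) (before G L i) k) → LayoutDegAtMost G s L k
    layoutDeg blockable i with supp-exists (before? i) (not-before-self i)
    ... | j , supp = j , supp , Equivalence.from (supp≤⇔blockable supp) (blockable i)

  module Escaper (R : Subset n) where

    escape? : ∀ F v → Dec (Escapes F v (minus G R v))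
    escape? F v = escapes? F v (minus? R v)

    next : ∀ F v → Dec (Escapes F v (minus G R v)) → V G
    next F v (yes (y , _)) = y
    next F v (no _)        = v

    next-valid : ∀ F v d → next F v d ≡ v ⊎ (next F v d ≢ v × SPathAvoiding G s F v (next F v d))
    next-valid F v (yes (y , (_ , y≢v) , path)) = inj₂ (y≢v , path)
    next-valid F v (no _)                       = inj₁ refl

    next-step : ∀ F v d → minus G R v (next F v d) ⊎ Blocks G s v (minus G R v) F
    next-step F v (yes (y , y∈R-v , _)) = inj₁ y∈R-v
    next-step F v (no ¬escape)          = inj₂ (¬escapes⇒blocks ¬escape)

    robber : V G → RobberStrategy G s
    robber start = record
      { start = start
      ; g     = λ F v → next F v (escape? F v)
      ; valid = λ F v → next-valid F v (escape? F v)
      }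

  module _ (k : ℕ) where

    copWins⇒noHideOut : CopNumberAtMost G s k → NoNonemptyHideOut G (suc k) s
    copWins⇒noHideOut (cop , cost , wins) R (x₀ , x₀∈R) isHideOut = runs (wins (robber x₀))
      where
      open Escaper R
      moves : ∀ v → v ∈ R → minus G R v (next (cop v) v (escape? (cop v) v))
      moves v v∈R = [ id , (λ blocks → ⊥-elim (unblockable v v∈R (cop v , blocks , cost v))) ]′
                    (next-step (cop v) v (escape? (cop v) v))
        where unblockable = Equivalence.to (hideOut⇔unblockable {k} {R}) isHideOut
      stays : ∀ i → position G cop (robber x₀) i ∈ R
      stays zero    = x₀∈R
      stays (suc i) = proj₁ (moves _ (stays i))
      runs : ¬ CopWinning G cop (robber x₀)
      runs (i , caught) = proj₂ (moves _ (stays i)) caught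

    degeneracy⇒copWins : EdgeDegAtMost G s k → CopNumberAtMost G s k
    degeneracy⇒copWins (L , deg) = cop , (λ v → proj₂ (proj₂ (blockable (index v)))) , wins
      where
      open Layout L
      blockable : ∀ i → Blockable (at i) (before G L i) k
      blockable = Equivalence.to (layoutDeg⇔blockable {L} {k}) deg
      located : ∀ v → ∃ λ i → at i ≡ v
      located = injective⇒surjective inj
      index : V G → Fin n
      index v = proj₁ (located v)
      cop : CopStrategy G
      cop v = proj₁ (blockable (index v))
      index-injective : ∀ {u v} → index u ≡ index v → u ≡ v
      index-injective {u} {v} eq = begin
        u             ≡⟨ proj₂ (located u) ⟨
        at (index u)  ≡⟨ cong at eq ⟩
        at (index v)  ≡⟨ proj₂ (located v) ⟩
        v             ∎
        where open ≡-Reasoning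
      guards : ∀ v → Blocks G s v (before G L (index v)) (cop v)
      guards v = subst (λ x → Blocks G s x (before G L (index v)) (cop v))
                       (proj₂ (located v)) (proj₁ (proj₂ (blockable (index v))))
      advances : (R : RobberStrategy G s) → ∀ v → let u = RobberStrategy.g R (cop v) v in
                 u ≢ v → index v Fin.< index u
      advances R v moved with RobberStrategy.valid R (cop v) v
      ... | inj₁ stayed = ⊥-elim (moved stayed)
      ... | inj₂ (_ , path) = ℕ.≰⇒> behind⇒blocked
        where
        u = RobberStrategy.g R (cop v) v
        behind⇒blocked : ¬ index u Fin.≤ index v
        behind⇒blocked u≤v = blocks⇒¬escapes (guards v) (u , (index u , u<v , proj₂ (located u)) , path)
          where u<v = Fin.≤∧≢⇒< u≤v (moved ∘ index-injective)
      wins : (R : RobberStrategy G s) → CopWinning G cop R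
      wins R = rank-increasing⇒stalls Fin._≟_ index (position G cop R)
                                      (λ i → advances R (position G cop R i))

    Later : ∀ {t} → (Fin t → V G) → Fin t → Pred (V G) 0ℓ
    Later vertex c y = ∃ λ c′ → c Fin.< c′ × vertex c′ ≡ y

    record EliminationOrder (R : Subset n) (t : ℕ) : Set where
      field
        vertex    : Fin t → V G
        injective : Injective _≡_ _≡_ vertex
        vertex∈R  : ∀ c → vertex c ∈ R
        sparse    : ∀ c → Blockable (vertex c) (Later vertex c) k

    eliminate-first : ∀ {R t x} → x ∈ R → Blockable x (minus G R x) k →
                      EliminationOrder (R - x) t → EliminationOrder R (suc t)
    eliminate-first {R} {t} {x} x∈R x-blockable rest = record
      { vertex = vertex ; injective = injective ; vertex∈R = vertex∈R ; sparse = sparse }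
      where
      module Rest = EliminationOrder rest
      vertex : Fin (suc t) → V G
      vertex Fin.zero    = x
      vertex (Fin.suc c) = Rest.vertex c
      rest≢x : ∀ c → Rest.vertex c ≢ x
      rest≢x c = x∈p-y⇒x≢y (Rest.vertex∈R c)
      injective : Injective _≡_ _≡_ vertex
      injective {Fin.zero}  {Fin.zero}  _  = refl
      injective {Fin.zero}  {Fin.suc d} eq = ⊥-elim (rest≢x d (sym eq))
      injective {Fin.suc c} {Fin.zero}  eq = ⊥-elim (rest≢x c eq)
      injective {Fin.suc c} {Fin.suc d} eq = cong Fin.suc (Rest.injective eq)
      vertex∈R : ∀ c → vertex c ∈ R
      vertex∈R Fin.zero    = x∈R
      vertex∈R (Fin.suc c) = p─q⊆p R _ (Rest.vertex∈R c)
      sparse : ∀ c → Blockable (vertex c) (Later vertex c) k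
      sparse Fin.zero = blockable-antitone later-in-R x-blockable
        where
        later-in-R : Later vertex Fin.zero ⊆ minus G R x
        later-in-R (Fin.suc d , _ , refl) = vertex∈R (Fin.suc d) , rest≢x d
      sparse (Fin.suc c) = blockable-antitone later-in-rest (Rest.sparse c)
        where
        later-in-rest : Later vertex (Fin.suc c) ⊆ Later Rest.vertex c
        later-in-rest (Fin.suc d , s≤s c<d , same) = d , c<d , same

    eliminationOrder : NoNonemptyHideOut G (suc k) s → ∀ t R → ∣ R ∣ ≡ t → EliminationOrder R t
    eliminationOrder _ zero R _ = record
      { vertex = λ () ; injective = λ { {()} } ; vertex∈R = λ () ; sparse = λ () }
    eliminationOrder noHideOut (suc t) R size
      with Fin.any? (λ x → (x ∈? R) ×-dec blockable? (minus? R x) k)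
    ... | yes (x , x∈R , x-blockable) = eliminate-first x∈R x-blockable
          (eliminationOrder noHideOut t (R - x) (ℕ.suc-injective (trans (sym (∣p∣≡1+∣p-x∣ x∈R)) size)))
    ... | no none = ⊥-elim (noHideOut R (∣p∣≡1+c⇒Nonempty size)
          (Equivalence.from hideOut⇔unblockable λ x x∈R x-blockable → none (x , x∈R , x-blockable)))

    noHideOut⇒degeneracy : NoNonemptyHideOut G (suc k) s → EdgeDegAtMost G s k
    noHideOut⇒degeneracy noHideOut = layout , Equivalence.from (layoutDeg⇔blockable {layout} {k}) blockable
      where
      open EliminationOrder (eliminationOrder noHideOut n ⊤ (∣⊤∣≡n n))
      layout : Layout G
      layout = record { at = vertex ∘ opposite ; inj = opposite-injective ∘ injective }
      blockable : ∀ i → Blockable (Layout.at layout i) (before G layout i) k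
      blockable i = blockable-antitone before⊆later (sparse (opposite i))
        where
        before⊆later : before G layout i ⊆ Later vertex (opposite i)
        before⊆later (j , j<i , same) = opposite j , opposite-< j<i , same

theorem2 : (G : Graph) (s : Speed) → ValidSpeed s → (k : ℕ) →
    (CopNumberAtMost G s k ⇔ NoNonemptyHideOut G (suc k) s) ×
    (NoNonemptyHideOut G (suc k) s ⇔ EdgeDegAtMost G s k)
theorem2 G s _ k =
  mk⇔ (copWins⇒noHideOut G s k) (degeneracy⇒copWins G s k ∘ noHideOut⇒degeneracy G s k) ,
  mk⇔ (noHideOut⇒degeneracy G s k) (copWins⇒noHideOut G s k ∘ degeneracy⇒copWins G s k)
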